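{- Let $D$ be a positive square-free integer, $C$ a positive divisor of $D$, and $(M,L,\psi)\in\mathcal{H}(DC)$ with $\psi$ quadratic of conductor $f$. Then the Fourier expansion of $E_{M,L,\psi}$ at $[\infty]$ is \[E_{M,L,\psi}=a_0(E_{M,L,\psi};[\infty])+\sum_{n\ge1}\sigma_{M,L}(n)\psi(n)\mathfrak q^n,\] where $\sigma_{M,L}(n)=\Big(\sum_{d\mid n,\,(d,\frac Df)=1}d\Big)\cdot\prod_{\ell\mid\frac DM}\ell^{v_\ell(n)}$ if $n$ is prime to $(M,L)$, and $\sigma_{M,L}(n)=0$ otherwise.
   Context: $\mathfrak q=e^{2\pi iz}$; "quadratic" means $\psi^2=1$ (trivial allowed); $\psi$ extended by $0$ off integers prime to $f$; $v_\ell$ the $\ell$-adic valuation. For prime $p\nmid f$: $[p]^+_\psi g(z)=g(z)-p\psi(p)g(pz)$, $[p]^-_\psi g(z)=g(z)-\psi^{ -1}(p)g(pz)$; $[K]^\pm_\psi$ the composite over primes of square-free $K$ prime to $f$. $E_\psi(z)=-\frac{\delta_\psi}{4\pi i(z-\bar z)}+a_\psi+\sum_{n\ge1}\sigma_\psi(n)\mathfrak q^n$ ($\delta_\psi=1,a_\psi=-1/24$ if $\psi$ trivial, else $0$; $\sigma_\psi(n)=\sum_{d\mid n}d\psi(d)\psi^{ -1}(n/d)$). $\mathcal H(DC)$: triples $(M,L,\psi)$ with $M,L\mid D$, $M\neq1$, $D\mid ML\mid DC$, $\psi$ a character modulo $(M,L)$; $E_{M,L,\psi}=[L/f]^-_\psi\circ[M/f]^+_\psi(E_\psi)$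 (a holomorphic modular form). -}

module Defs where

open import Data.Nat as ℕ using (ℕ; zero; suc; _∸_; _^_; NonZero)
open import Data.Nat.Divisibility using (_∣_; _∣?_; quotient)
open import Data.Nat.GCD using (gcd)
open import Data.Nat.Primality using (Prime; prime?)
open import Data.Integer as ℤ using (ℤ; +_; 0ℤ; 1ℤ; _-_)
open import Data.List using (List; []; _∷_; foldr; map; filter; applyUpTo; length)
open import Relation.Nullary using (¬_; yes; no)
open import Relation.Nullary.Decidable using (_×-dec_)
open import Relation.Binary.PropositionalEquality using (_≡_; _≢_)
open import Data.Product using (_×_)
open import Data.Integer.Divisibility renaming (_∣_ to _ℤ∣_) using ()

sumℤ : List ℤ → ℤ
sumℤ = foldr ℤ._+_ 0ℤ

prodℕ : List ℕ → ℕ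
prodℕ = foldr ℕ._*_ 1

range1 : ℕ → List ℕ
range1 n = applyUpTo suc n

divisors : ℕ → List ℕ
divisors n = filter (λ d → d ∣? n) (range1 n)

primeDivisors : ℕ → List ℕ
primeDivisors K = filter (λ p → prime? p ×-dec (p ∣? K)) (range1 K)

-- ℓ-adic valuation of n ≥ 1 (ℓ ≥ 2): the number of k ∈ [1..n] with ℓ^k ∣ n,
-- i.e. the largest k with ℓ^k ∣ n.
val : ℕ → ℕ → ℕ
val ℓ n = length (filter (λ k → (ℓ ^ k) ∣? n) (range1 n))

SquareFree : ℕ → Set
SquareFree D = ∀ p → Prime p → ¬ ((p ℕ.* p) ∣ D)

-- Dirichlet characters (valued in ℤ, which suffices for quadratic ones),
-- viewed as functions on ℕ, zero off integers not prime to the modulus.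

record DirichletChar (N : ℕ) (ψ : ℕ → ℤ) : Set where
  field
    one      : ψ 1 ≡ 1ℤ
    mult     : ∀ m n → ψ (m ℕ.* n) ≡ ψ m ℤ.* ψ n
    periodic : ∀ n → ψ (n ℕ.+ N) ≡ ψ n
    zero-iff : ∀ n → (ψ n ≡ 0ℤ → gcd n N ≢ 1) × (gcd n N ≢ 1 → ψ n ≡ 0ℤ)

Quadratic : ℕ → (ℕ → ℤ) → Set
Quadratic N ψ = ∀ n → gcd n N ≡ 1 → ψ n ℤ.* ψ n ≡ 1ℤ

-- ψ (mod f) has conductor f, i.e. is primitive: no proper divisor d of f
-- is a period of ψ on integers prime to f.
Primitive : ℕ → (ℕ → ℤ) → Set
Primitive f ψ = ∀ d → d ∣ f →
  (∀ a b → gcd a f ≡ 1 → gcd b f ≡ 1 → (+ d) ℤ∣ (+ a - + b) → ψ a ≡ ψ b) → d ≡ f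

-- Holomorphic q-expansions at ∞, represented by their coefficient
-- sequences (index n ↦ coefficient of 𝔮^n).

QExp : Set
QExp = ℕ → ℤ

-- g(pz) : coefficient of 𝔮^n is a(n/p) if p ∣ n, else 0
dil : ℕ → QExp → QExp
dil p a n with p ∣? n
... | yes p∣n = a (quotient p∣n)
... | no  _   = 0ℤ

-- [p]⁺_ψ g(z) = g(z) − p ψ(p) g(pz)
opPlus : (ℕ → ℤ) → ℕ → QExp → QExp
opPlus ψ p a n = a n - (+ p) ℤ.* ψ p ℤ.* dil p a n

-- [p]⁻_ψ g(z) = g(z) − ψ⁻¹(p) g(pz)   (ψ⁻¹ = ψ for quadratic ψ)
opMinus : (ℕ → ℤ) → ℕ → QExp → QExp
opMinus ψ p a n = a n - ψ p ℤ.* dil p a n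

opPlusK : (ℕ → ℤ) → ℕ → QExp → QExp
opPlusK ψ K a = foldr (opPlus ψ) a (primeDivisors K)

opMinusK : (ℕ → ℤ) → ℕ → QExp → QExp
opMinusK ψ K a = foldr (opMinus ψ) a (primeDivisors K)

-- σ_ψ(n) = Σ_{d ∣ n} d ψ(d) ψ⁻¹(n/d)   (ψ⁻¹ = ψ for quadratic ψ)
σψ : (ℕ → ℤ) → ℕ → ℤ
σψ ψ n = sumℤ (map term (range1 n))
  where
  term : ℕ → ℤ
  term d with d ∣? n
  ... | yes d∣n = (+ d) ℤ.* ψ d ℤ.* ψ (quotient d∣n)
  ... | no  _   = 0ℤ

-- Coefficients of E_ψ for n ≥ 1 (the constant term / non-holomorphic part
-- is not modelled; coefficient index 0 is set to 0 and never used).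
Eψ : (ℕ → ℤ) → QExp
Eψ ψ zero    = 0ℤ
Eψ ψ (suc n) = σψ ψ (suc n)

-- E_{M,L,ψ} = [L/f]⁻_ψ ∘ [M/f]⁺_ψ (E_ψ), given Mf = M/f and Lf = L/f
EMLψ : (ℕ → ℤ) → (Mf Lf : ℕ) → QExp
EMLψ ψ Mf Lf = opMinusK ψ Lf (opPlusK ψ Mf (Eψ ψ))

-- σ_{M,L}(n), given N = (M,L), Df = D/f and DM = D/M
σML : (N Df DM : ℕ) → ℕ → ℤ
σML N Df DM n with gcd n N ℕ.≟ 1
... | no  _ = 0ℤ
... | yes _ =
  sumℤ (map +_ (filter (λ d → gcd d Df ℕ.≟ 1) (divisors n)))
  ℤ.* (+ prodℕ (map (λ ℓ → ℓ ^ val ℓ n) (primeDivisors DM)))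

module Submission where

-- As ψ is completely multiplicative, σ_ψ(n) = ψ(n) σ(n) and the operators
--     g ↦ g − c·g(pz) behind [p]^±_ψ commute with multiplication by ψ, so E_{M,L,ψ}(n) =
--     ψ(n) E_{M,L,1}(n) (EMLψ-twist); only n prime to f matter.
-- (2) Untwisted stages.  For a prime p and P invariant under d ↦ d p, σ[P](n) = σ[P ∖ p](n)
--     + p σ[P](n/p) (σ-decomposition, P ∖ p dropping the multiples of p), so [p]⁺ replaces P by
--     P ∖ p (plus-stage); by induction along the powers of p, σ[P](n) − σ[P](n/p) =
--     p^{v_p(n)} σ[P ∖ p](n) (σ-difference), and = [p ∤ n] σ[P](n) if P excludes multiples of p.
--     So each prime q of L/f in [L/f]⁻ contributes a local factor (minus-stage).
-- (3) Identification.  For square-free D, the primes of D/f, of (M, L) off f and of D/M are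
--     described through those of M/f and L/f, which turns (2) into σ_{M,L}(n).

open import Defs
open import Data.Nat using (ℕ; _*_; _/_; _≤_; NonZero)
open import Data.Nat.Divisibility using (_∣_)
open import Data.Nat.GCD using (gcd)
open import Data.Integer as ℤ using (ℤ)
open import Relation.Binary.PropositionalEquality using (_≡_; _≢_)

open import Data.Nat as ℕ using (zero; suc; _+_; _^_; _<_; s≤s; z≤n; >-nonZero)
import Data.Nat.Properties as ℕP
open import Data.Nat.Divisibility
open import Data.Nat.DivMod using (m/n*n≡m)
open import Data.Nat.GCD using (gcd-greatest; gcd[m,n]∣m; gcd[m,n]∣n)
open import Data.Nat.Coprimality using (Coprime; coprime-divisor; coprime⇒gcd≡1)
open import Data.Nat.Induction using (<-rec)
open import Data.Nat.ListAction using (product)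
open import Data.Nat.Primality
  using (Prime; prime?; prime⇒irreducible; prime⇒nonTrivial; prime⇒nonZero; euclidsLemma)
open import Data.Nat.Primality.Factorisation using (factorise)
open import Data.Integer using (+_; 0ℤ; 1ℤ; _-_)
import Data.Integer.Properties as ℤP
open import Data.Integer.Tactic.RingSolver using (solve-∀)
open import Data.Bool using (Bool; true; false; if_then_else_)
open import Data.Bool.Properties using (¬-not)
open import Data.List using (List; []; _∷_; [_]; _++_; foldr; map; filter; applyUpTo; length)
import Data.List.Properties as LP
open import Data.List.Membership.Propositional using (_∈_)
open import Data.List.Membership.Propositional.Properties
  using (∈-++⁺ˡ; ∈-++⁺ʳ; ∈-filter⁺; ∈-applyUpTo⁺)
open import Data.List.Relation.Unary.Any using (here; there)
open import Data.List.Relation.Unary.All as All using (All; []; _∷_)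
import Data.List.Relation.Unary.All.Properties as All
open import Data.List.Relation.Unary.AllPairs using (_∷_)
open import Data.List.Relation.Unary.Unique.Propositional using (Unique)
import Data.List.Relation.Unary.Unique.Propositional.Properties as Unique
open import Data.Product using (Σ; _,_; _×_; proj₁; proj₂)
open import Data.Sum as Sum using (_⊎_; inj₁; inj₂)
open import Data.Empty using (⊥; ⊥-elim)
open import Function using (_∘_)
open import Relation.Nullary using (¬_; yes; no; does; Dec)
open import Relation.Nullary.Decidable using (_×-dec_; ¬?; dec-true; dec-false)
open import Relation.Unary using (Decidable; _≐_)
open import Relation.Unary.Properties using (_∩?_)
open import Relation.Binary.PropositionalEquality
  using (refl; sym; trans; cong; cong₂; subst; subst₂; module ≡-Reasoning)

cofactor-pos : ∀ m {k} → 1 ≤ m * k → 1 ≤ m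
cofactor-pos (suc m) _ = s≤s z≤n

>1⇒nonZero : ∀ {n} → 1 < n → NonZero n
>1⇒nonZero (s≤s (s≤s _)) = _

prime>1 : ∀ {p} → Prime p → 1 < p
prime>1 {p} pr = ℕ.nonTrivial⇒n>1 p ⦃ prime⇒nonTrivial pr ⦄

-- Integer sums Σ_{d=1}^{N} g d, built from the right so that N ↦ N + 1 adds one term.
sumTo : (ℕ → ℤ) → ℕ → ℤ
sumTo g zero    = 0ℤ
sumTo g (suc N) = sumTo g N ℤ.+ g (suc N)

sumℤ-applyUpTo-snoc : ∀ (g : ℕ → ℤ) (f : ℕ → ℕ) k →
  sumℤ (map g (applyUpTo f (suc k))) ≡ sumℤ (map g (applyUpTo f k)) ℤ.+ g (f k)
sumℤ-applyUpTo-snoc g f zero    = ℤP.+-comm (g (f 0)) 0ℤ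
sumℤ-applyUpTo-snoc g f (suc k) =
  trans (cong (λ x → g (f 0) ℤ.+ x) (sumℤ-applyUpTo-snoc g (λ x → f (suc x)) k))
        (sym (ℤP.+-assoc (g (f 0)) _ _))

sumℤ-range1 : ∀ g N → sumℤ (map g (range1 N)) ≡ sumTo g N
sumℤ-range1 g zero    = refl
sumℤ-range1 g (suc N) =
  trans (sumℤ-applyUpTo-snoc g suc N) (cong (ℤ._+ g (suc N)) (sumℤ-range1 g N))

sumTo-cong : ∀ {g h : ℕ → ℤ} N → (∀ d → 1 ≤ d → d ≤ N → g d ≡ h d) → sumTo g N ≡ sumTo h N
sumTo-cong zero    e = refl
sumTo-cong (suc N) e =
  cong₂ ℤ._+_ (sumTo-cong N (λ d 1≤d d≤N → e d 1≤d (ℕP.m≤n⇒m≤1+n d≤N)))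
              (e (suc N) (s≤s z≤n) ℕP.≤-refl)

sumTo-zero : ∀ (g : ℕ → ℤ) N → (∀ d → 1 ≤ d → d ≤ N → g d ≡ 0ℤ) → sumTo g N ≡ 0ℤ
sumTo-zero g N e = trans (sumTo-cong N e) (sumTo-0 N)
  where
  sumTo-0 : ∀ N → sumTo (λ _ → 0ℤ) N ≡ 0ℤ
  sumTo-0 zero    = refl
  sumTo-0 (suc N) = cong (ℤ._+ 0ℤ) (sumTo-0 N)

sumTo-+ : ∀ (g h : ℕ → ℤ) N → sumTo (λ d → g d ℤ.+ h d) N ≡ sumTo g N ℤ.+ sumTo h N
sumTo-+ g h zero    = refl
sumTo-+ g h (suc N) =
  trans (cong (ℤ._+ (g (suc N) ℤ.+ h (suc N))) (sumTo-+ g h N))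
        (interchange (sumTo g N) (sumTo h N) (g (suc N)) (h (suc N)))
  where
  interchange : ∀ a b c d → a ℤ.+ b ℤ.+ (c ℤ.+ d) ≡ a ℤ.+ c ℤ.+ (b ℤ.+ d)
  interchange = solve-∀

sumTo-*ˡ : ∀ c (g : ℕ → ℤ) N → sumTo (λ d → c ℤ.* g d) N ≡ c ℤ.* sumTo g N
sumTo-*ˡ c g zero    = sym (ℤP.*-zeroʳ c)
sumTo-*ˡ c g (suc N) =
  trans (cong (ℤ._+ (c ℤ.* g (suc N))) (sumTo-*ˡ c g N)) (sym (ℤP.*-distribˡ-+ c _ _))

sumTo-split : ∀ (g : ℕ → ℤ) c k → sumTo g (c + k) ≡ sumTo g c ℤ.+ sumTo (λ j → g (c + j)) k
sumTo-split g c zero    = trans (cong (sumTo g) (ℕP.+-identityʳ c)) (sym (ℤP.+-identityʳ _))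
sumTo-split g c (suc k) = begin
    sumTo g (c + suc k)
  ≡⟨ cong (sumTo g) (ℕP.+-suc c k) ⟩
    sumTo g (c + k) ℤ.+ g (suc (c + k))
  ≡⟨ cong₂ ℤ._+_ (sumTo-split g c k) (cong g (sym (ℕP.+-suc c k))) ⟩
    sumTo g c ℤ.+ sumTo (λ j → g (c + j)) k ℤ.+ g (c + suc k)
  ≡⟨ ℤP.+-assoc (sumTo g c) _ _ ⟩
    sumTo g c ℤ.+ sumTo (λ j → g (c + j)) (suc k) ∎
  where open ≡-Reasoning

sumTo-extend : ∀ (g : ℕ → ℤ) {N N'} → N ≤ N' → (∀ d → N < d → d ≤ N' → g d ≡ 0ℤ) →
  sumTo g N' ≡ sumTo g N
sumTo-extend g {N} N≤N' vanish with ℕP.m≤n⇒∃[o]m+o≡n N≤N'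
... | k , refl =
  trans (sumTo-split g N k)
        (trans (cong (λ x → sumTo g N ℤ.+ x) (sumTo-zero _ k tail-vanishes)) (ℤP.+-identityʳ _))
  where
  tail-vanishes : ∀ j → 1 ≤ j → j ≤ k → g (N + j) ≡ 0ℤ
  tail-vanishes j 1≤j j≤k =
    vanish (N + j) (subst (_≤ N + j) (ℕP.+-comm N 1) (ℕP.+-monoʳ-≤ N 1≤j)) (ℕP.+-monoʳ-≤ N j≤k)

onMultiples : ℕ → (ℕ → ℤ) → ℕ → ℤ
onMultiples p g d with p ∣? d
... | yes _ = g d
... | no  _ = 0ℤ

onMultiples-∣ : ∀ {p} g {d} → p ∣ d → onMultiples p g d ≡ g d
onMultiples-∣ {p} g {d} p∣d with p ∣? d
... | yes _  = refl
... | no p∤d = ⊥-elim (p∤d p∣d)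

onMultiples-∤ : ∀ {p} g {d} → ¬ p ∣ d → onMultiples p g d ≡ 0ℤ
onMultiples-∤ {p} g {d} p∤d with p ∣? d
... | yes p∣d = ⊥-elim (p∤d p∣d)
... | no _    = refl

-- When p ∣ c, the only multiple of p among c+1, …, c+p is c+p.
sumTo-block : ∀ p .⦃ _ : NonZero p ⦄ (g : ℕ → ℤ) c → p ∣ c →
  sumTo (λ j → onMultiples p g (c + j)) p ≡ g (c + p)
sumTo-block p@(suc p-1) g c p∣c =
  trans (cong₂ ℤ._+_ (sumTo-zero _ p-1 inner-vanishes) (onMultiples-∣ g (∣m∣n⇒∣m+n p∣c ∣-refl)))
        (ℤP.+-identityˡ _)
  where
  inner-vanishes : ∀ j → 1 ≤ j → j ≤ p-1 → onMultiples p g (c + j) ≡ 0ℤ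
  inner-vanishes j 1≤j j≤p-1 = onMultiples-∤ g λ p∣c+j →
    ℕP.<⇒≱ (s≤s j≤p-1) (∣⇒≤ ⦃ >-nonZero 1≤j ⦄ (∣m+n∣m⇒∣n p∣c+j p∣c))

sumTo-multiples : ∀ p .⦃ _ : NonZero p ⦄ (g : ℕ → ℤ) m →
  sumTo (onMultiples p g) (m * p) ≡ sumTo (λ e → g (e * p)) m
sumTo-multiples p g zero    = refl
sumTo-multiples p g (suc m) = begin
    sumTo (onMultiples p g) (p + m * p)
  ≡⟨ cong (sumTo (onMultiples p g)) (ℕP.+-comm p (m * p)) ⟩
    sumTo (onMultiples p g) (m * p + p)
  ≡⟨ sumTo-split (onMultiples p g) (m * p) p ⟩
    sumTo (onMultiples p g) (m * p) ℤ.+ sumTo (λ j → onMultiples p g (m * p + j)) p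
  ≡⟨ cong₂ ℤ._+_ (sumTo-multiples p g m) (sumTo-block p g (m * p) (n∣m*n m)) ⟩
    sumTo (λ e → g (e * p)) m ℤ.+ g (m * p + p)
  ≡⟨ cong (λ x → sumTo (λ e → g (e * p)) m ℤ.+ g x) (ℕP.+-comm (m * p) p) ⟩
    sumTo (λ e → g (e * p)) (suc m) ∎
  where open ≡-Reasoning

dil-∣ : ∀ p .⦃ _ : NonZero p ⦄ (a : QExp) m → dil p a (m * p) ≡ a m
dil-∣ p a m with p ∣? (m * p)
... | yes (divides k eq) = cong a (sym (ℕP.*-cancelʳ-≡ m k p eq))
... | no p∤mp            = ⊥-elim (p∤mp (n∣m*n m))

dil-∤ : ∀ {p} (a : QExp) {n} → ¬ p ∣ n → dil p a n ≡ 0ℤ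
dil-∤ {p} a {n} p∤n with p ∣? n
... | yes p∣n = ⊥-elim (p∤n p∣n)
... | no _    = refl

divisorTerm : (ℕ → Bool) → ℕ → ℕ → ℤ
divisorTerm P n d with d ∣? n
... | yes _ = if P d then + d else 0ℤ
... | no  _ = 0ℤ

σ[_] : (ℕ → Bool) → ℕ → ℤ
σ[ P ] n = sumTo (divisorTerm P n) n

divisorTerm-∣ : ∀ P {n d} → d ∣ n → divisorTerm P n d ≡ (if P d then + d else 0ℤ)
divisorTerm-∣ P {n} {d} d∣n with d ∣? n
... | yes _  = refl
... | no d∤n = ⊥-elim (d∤n d∣n)

divisorTerm-∤ : ∀ P {n d} → ¬ d ∣ n → divisorTerm P n d ≡ 0ℤ
divisorTerm-∤ P {n} {d} d∤n with d ∣? n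
... | yes d∣n = ⊥-elim (d∤n d∣n)
... | no _    = refl

divisorTerm-false : ∀ P {n d} → P d ≡ false → divisorTerm P n d ≡ 0ℤ
divisorTerm-false P {n} {d} Pd with d ∣? n
... | yes _ rewrite Pd = refl
... | no _  = refl

divisorTerm-cong : ∀ P Q n d → P d ≡ Q d → divisorTerm P n d ≡ divisorTerm Q n d
divisorTerm-cong P Q n d eq with d ∣? n
... | yes _ = cong (λ b → if b then + d else 0ℤ) eq
... | no _  = refl

_∖_ : (ℕ → Bool) → ℕ → ℕ → Bool
(P ∖ p) d with p ∣? d
... | yes _ = false
... | no  _ = P d

∖-∣ : ∀ P {p d} → p ∣ d → (P ∖ p) d ≡ false
∖-∣ P {p} {d} p∣d with p ∣? d
... | yes _  = refl
... | no p∤d = ⊥-elim (p∤d p∣d)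

∖-∤ : ∀ P {p d} → ¬ p ∣ d → (P ∖ p) d ≡ P d
∖-∤ P {p} {d} p∤d with p ∣? d
... | yes p∣d = ⊥-elim (p∤d p∣d)
... | no _    = refl

Invariant : ℕ → (ℕ → Bool) → Set
Invariant p P = ∀ e → P (e * p) ≡ P e

Excludes : ℕ → (ℕ → Bool) → Set
Excludes p P = ∀ d → P d ≡ true → ¬ p ∣ d

∖-excludes : ∀ P p → Excludes p (P ∖ p)
∖-excludes P p d holds p∣d with () ← trans (sym (∖-∣ P p∣d)) holds

σ-∖-coprime : ∀ P {p n} → ¬ p ∣ n → σ[ P ∖ p ] n ≡ σ[ P ] n
σ-∖-coprime P {p} {n} p∤n = sumTo-cong n λ d _ _ → same d (d ∣? n)
  where
  same : ∀ d → Dec (d ∣ n) → divisorTerm (P ∖ p) n d ≡ divisorTerm P n d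
  same d (yes d∣n) = divisorTerm-cong (P ∖ p) P n d (∖-∤ P λ p∣d → p∤n (∣-trans p∣d d∣n))
  same d (no d∤n)  = trans (divisorTerm-∤ _ d∤n) (sym (divisorTerm-∤ _ d∤n))

∣-cancel-prime : ∀ {p d} m → Prime p → ¬ p ∣ d → d ∣ m * p → d ∣ m
∣-cancel-prime {p} {d} m pr p∤d d∣mp =
  coprime-divisor d⊥p (subst (d ∣_) (ℕP.*-comm m p) d∣mp)
  where
  d⊥p : Coprime d p
  d⊥p (i∣d , i∣p) with prime⇒irreducible pr i∣p
  ... | inj₁ i≡1 = i≡1
  ... | inj₂ refl = ⊥-elim (p∤d i∣d)

σ-excluded : ∀ P {p} m → Prime p → Excludes p P → 1 ≤ m → σ[ P ] (m * p) ≡ σ[ P ] m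
σ-excluded P {p} m pr excl 1≤m =
  trans (sumTo-cong (m * p) λ d _ _ → same d (P d) refl)
        (sumTo-extend (divisorTerm P m) m≤mp λ d m<d _ →
          divisorTerm-∤ P λ d∣m → ℕP.<⇒≱ m<d (∣⇒≤ ⦃ >-nonZero 1≤m ⦄ d∣m))
  where
  m≤mp : m ≤ m * p
  m≤mp = ℕP.<⇒≤ (ℕP.m<m*n m p ⦃ >-nonZero 1≤m ⦄ (prime>1 pr))
  same : ∀ d b → P d ≡ b → divisorTerm P (m * p) d ≡ divisorTerm P m d
  same d false Pd = trans (divisorTerm-false P Pd) (sym (divisorTerm-false P Pd))
  same d true  Pd = by-cases (d ∣? m)
    where
    by-cases : Dec (d ∣ m) → divisorTerm P (m * p) d ≡ divisorTerm P m d
    by-cases (yes d∣m) = trans (divisorTerm-∣ P (∣m⇒∣m*n p d∣m)) (sym (divisorTerm-∣ P d∣m))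
    by-cases (no d∤m)  =
      trans (divisorTerm-∤ P (d∤m ∘ ∣-cancel-prime m pr (excl d Pd))) (sym (divisorTerm-∤ P d∤m))

divisorTerm-split : ∀ P p n d →
  divisorTerm P n d ≡ divisorTerm (P ∖ p) n d ℤ.+ onMultiples p (divisorTerm P n) d
divisorTerm-split P p n d with p ∣? d
... | yes p∣d = sym (trans (cong (ℤ._+ divisorTerm P n d) (divisorTerm-false (P ∖ p) (∖-∣ P p∣d)))
                           (ℤP.+-identityˡ _))
... | no p∤d  = sym (trans (cong (ℤ._+ 0ℤ) (divisorTerm-cong (P ∖ p) P n d (∖-∤ P p∤d)))
                           (ℤP.+-identityʳ _))

divisorTerm-scale : ∀ P {p} .⦃ _ : NonZero p ⦄ m e → Invariant p P →
  divisorTerm P (m * p) (e * p) ≡ + p ℤ.* divisorTerm P m e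
divisorTerm-scale P {p} m e inv = by-cases (e ∣? m)
  where
  scale : ∀ b → (if b then + (e * p) else 0ℤ) ≡ + p ℤ.* (if b then + e else 0ℤ)
  scale true  = trans (ℤP.pos-* e p) (ℤP.*-comm (+ e) (+ p))
  scale false = sym (ℤP.*-zeroʳ (+ p))
  by-cases : Dec (e ∣ m) → divisorTerm P (m * p) (e * p) ≡ + p ℤ.* divisorTerm P m e
  by-cases (yes e∣m) = begin
      divisorTerm P (m * p) (e * p)
    ≡⟨ divisorTerm-∣ P (*-monoˡ-∣ p e∣m) ⟩
      (if P (e * p) then + (e * p) else 0ℤ)
    ≡⟨ cong (λ b → if b then + (e * p) else 0ℤ) (inv e) ⟩
      (if P e then + (e * p) else 0ℤ)
    ≡⟨ scale (P e) ⟩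
      + p ℤ.* (if P e then + e else 0ℤ)
    ≡⟨ cong (+ p ℤ.*_) (divisorTerm-∣ P e∣m) ⟨
      + p ℤ.* divisorTerm P m e ∎
    where open ≡-Reasoning
  by-cases (no e∤m) =
    trans (divisorTerm-∤ P (e∤m ∘ *-cancelʳ-∣ p))
          (trans (sym (ℤP.*-zeroʳ (+ p))) (cong (+ p ℤ.*_) (sym (divisorTerm-∤ P e∤m))))

σ-p-part : ∀ P p .⦃ _ : NonZero p ⦄ m → Invariant p P →
  σ[ P ] (m * p) ≡ σ[ P ∖ p ] (m * p) ℤ.+ + p ℤ.* σ[ P ] m
σ-p-part P p m inv = begin
    sumTo (divisorTerm P n) n
  ≡⟨ sumTo-cong n (λ d _ _ → divisorTerm-split P p n d) ⟩
    sumTo (λ d → divisorTerm (P ∖ p) n d ℤ.+ onMultiples p (divisorTerm P n) d) n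
  ≡⟨ sumTo-+ _ _ n ⟩
    σ[ P ∖ p ] n ℤ.+ sumTo (onMultiples p (divisorTerm P n)) n
  ≡⟨ cong (λ x → σ[ P ∖ p ] n ℤ.+ x) (sumTo-multiples p (divisorTerm P n) m) ⟩
    σ[ P ∖ p ] n ℤ.+ sumTo (λ e → divisorTerm P n (e * p)) m
  ≡⟨ cong (λ x → σ[ P ∖ p ] n ℤ.+ x) (sumTo-cong m (λ e _ _ → divisorTerm-scale P m e inv)) ⟩
    σ[ P ∖ p ] n ℤ.+ sumTo (λ e → + p ℤ.* divisorTerm P m e) m
  ≡⟨ cong (λ x → σ[ P ∖ p ] n ℤ.+ x) (sumTo-*ˡ (+ p) (divisorTerm P m) m) ⟩
    σ[ P ∖ p ] n ℤ.+ + p ℤ.* σ[ P ] m ∎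
  where
  open ≡-Reasoning
  n : ℕ
  n = m * p

-- The same identity for all n, with σ[P](n / p) read as 0 when p ∤ n.
σ-decomposition : ∀ P p .⦃ _ : NonZero p ⦄ n → Invariant p P →
  σ[ P ] n ≡ σ[ P ∖ p ] n ℤ.+ + p ℤ.* dil p σ[ P ] n
σ-decomposition P p n inv with p ∣? n
... | yes (divides m refl) = σ-p-part P p m inv
... | no p∤n = sym (trans (cong (λ x → σ[ P ∖ p ] n ℤ.+ x) (ℤP.*-zeroʳ (+ p)))
                          (trans (ℤP.+-identityʳ _) (σ-∖-coprime P p∤n)))

p-induction : ∀ {p} → 1 < p → (G : ℕ → Set) →
  (∀ n → 1 ≤ n → ¬ p ∣ n → G n) → (∀ m → 1 ≤ m → G m → G (m * p)) →
  ∀ n → 1 ≤ n → G n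
p-induction {p} 1<p G base step = <-rec (λ n → 1 ≤ n → G n) go
  where
  go : ∀ n → (∀ {m} → m < n → 1 ≤ m → G m) → 1 ≤ n → G n
  go n rec 1≤n with p ∣? n
  ... | no p∤n               = base n 1≤n p∤n
  ... | yes (divides m refl) = step m 1≤m (rec (ℕP.m<m*n m p ⦃ >-nonZero 1≤m ⦄ 1<p) 1≤m)
    where
    1≤m : 1 ≤ m
    1≤m = cofactor-pos m 1≤n

count-initial-segment : ∀ {P : ℕ → Set} (P? : Decidable P) N v → v ≤ N →
  (∀ k → 1 ≤ k → k ≤ N → (P k → k ≤ v) × (k ≤ v → P k)) →
  length (filter P? (range1 N)) ≡ v
count-initial-segment P? zero    .zero z≤n spec = refl
count-initial-segment {P} P? (suc N) v v≤1+N spec = begin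
    length (filter P? (range1 (suc N)))
  ≡⟨ cong (λ xs → length (filter P? xs)) (LP.applyUpTo-∷ʳ suc N) ⟨
    length (filter P? (range1 N ++ [ suc N ]))
  ≡⟨ cong length (LP.filter-++ P? (range1 N) [ suc N ]) ⟩
    length (filter P? (range1 N) ++ filter P? [ suc N ])
  ≡⟨ LP.length-++ (filter P? (range1 N)) ⟩
    length (filter P? (range1 N)) + length (filter P? [ suc N ])
  ≡⟨ last-step (v ℕP.≤? N) ⟩
    v ∎
  where
  open ≡-Reasoning
  spec-last : (P (suc N) → suc N ≤ v) × (suc N ≤ v → P (suc N))
  spec-last = spec (suc N) (s≤s z≤n) ℕP.≤-refl
  last-step : Dec (v ≤ N) → length (filter P? (range1 N)) + length (filter P? [ suc N ]) ≡ v
  last-step (yes v≤N) =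
    trans (cong₂ _+_ (count-initial-segment P? N v v≤N λ k 1≤k k≤N → spec k 1≤k (ℕP.m≤n⇒m≤1+n k≤N))
                     (cong length (LP.filter-reject P? λ P[1+N] →
                       ℕP.<-irrefl refl (ℕP.≤-trans (proj₁ spec-last P[1+N]) v≤N))))
          (ℕP.+-identityʳ v)
  last-step (no v≰N) =
    trans (cong₂ _+_ (count-initial-segment P? N N ℕP.≤-refl λ k 1≤k k≤N →
                        (λ _ → k≤N) , (λ _ → proj₂ (spec k 1≤k (ℕP.m≤n⇒m≤1+n k≤N)) (ℕP.≤-trans k≤N N≤v)))
                     (cong length (LP.filter-accept P? (proj₂ spec-last (ℕP.≤-reflexive (sym v≡1+N))))))
          (trans (ℕP.+-comm N 1) (sym v≡1+N))
    where
    v≡1+N : v ≡ suc N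
    v≡1+N = ℕP.≤-antisym v≤1+N (ℕP.≰⇒> v≰N)
    N≤v : N ≤ v
    N≤v = ℕP.≤-trans (ℕP.n≤1+n N) (ℕP.≤-reflexive (sym v≡1+N))

k<ℓ^k : ∀ {ℓ} → 1 < ℓ → ∀ k → k < ℓ ^ k
k<ℓ^k 1<ℓ zero        = s≤s z≤n
k<ℓ^k {ℓ} 1<ℓ (suc k) = ℕP.<-≤-trans (s≤s (k<ℓ^k 1<ℓ k)) (ℕP.^-monoʳ-< ℓ 1<ℓ (ℕP.n<1+n k))

ℓ^suc : ∀ ℓ k → ℓ ^ suc k ≡ ℓ ^ k * ℓ
ℓ^suc ℓ k = ℕP.*-comm ℓ (ℓ ^ k)

record ExactPower (ℓ v n : ℕ) : Set where
  constructor exactly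
  field
    power-∣   : ℓ ^ v ∣ n
    power-suc : ¬ ℓ ^ suc v ∣ n

-- val ℓ n is the exponent of the exact power of ℓ dividing n: the k ∈ [1..n] with ℓ^k ∣ n
-- are exactly the k ≤ v.
val-char : ∀ {ℓ n v} → 1 < ℓ → 1 ≤ n → ExactPower ℓ v n → val ℓ n ≡ v
val-char {ℓ} {n} {v} 1<ℓ 1≤n (exactly ℓ^v∣n ℓ^1+v∤n) =
  count-initial-segment (λ k → ℓ ^ k ∣? n) n v v≤n
    λ k _ _ → below k , (λ k≤v → ∣-trans (power-∣ k≤v) ℓ^v∣n)
  where
  v≤n : v ≤ n
  v≤n = ℕP.<⇒≤ (ℕP.<-≤-trans (k<ℓ^k 1<ℓ v) (∣⇒≤ ⦃ >-nonZero 1≤n ⦄ ℓ^v∣n))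
  power-∣ : ∀ {a b} → a ≤ b → ℓ ^ a ∣ ℓ ^ b
  power-∣ {a} a≤b with ℕP.m≤n⇒∃[o]m+o≡n a≤b
  ... | c , refl = subst (ℓ ^ a ∣_) (sym (ℕP.^-distribˡ-+-* ℓ a c)) (m∣m*n (ℓ ^ c))
  below : ∀ k → ℓ ^ k ∣ n → k ≤ v
  below k ℓ^k∣n with k ℕP.≤? v
  ... | yes k≤v = k≤v
  ... | no k≰v  = ⊥-elim (ℓ^1+v∤n (∣-trans (power-∣ (ℕP.≰⇒> k≰v)) ℓ^k∣n))

exactPower-coprime : ∀ {ℓ n} → ¬ ℓ ∣ n → ExactPower ℓ 0 n
exactPower-coprime {ℓ} {n} ℓ∤n = exactly (1∣ n) (ℓ∤n ∘ subst (_∣ n) (ℕP.*-identityʳ ℓ))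

exactPower-mul-self : ∀ {ℓ v m} → 1 < ℓ → ExactPower ℓ v m → ExactPower ℓ (suc v) (m * ℓ)
exactPower-mul-self {ℓ} {v} {m} 1<ℓ (exactly ℓ^v∣m ℓ^1+v∤m) = exactly
  (subst (_∣ m * ℓ) (sym (ℓ^suc ℓ v)) (*-monoˡ-∣ ℓ ℓ^v∣m))
  λ ℓ^2+v∣mℓ → ℓ^1+v∤m (*-cancelʳ-∣ ℓ ⦃ >1⇒nonZero 1<ℓ ⦄
                          (subst (_∣ m * ℓ) (ℓ^suc ℓ (suc v)) ℓ^2+v∣mℓ))

exact-power : ∀ {ℓ} → 1 < ℓ → ∀ n → 1 ≤ n → Σ ℕ λ v → ExactPower ℓ v n
exact-power {ℓ} 1<ℓ = p-induction 1<ℓ (λ n → Σ ℕ λ v → ExactPower ℓ v n)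
  (λ _ _ ℓ∤n → 0 , exactPower-coprime ℓ∤n)
  (λ _ _ (v , exact) → suc v , exactPower-mul-self 1<ℓ exact)

val-coprime : ∀ {ℓ n} → 1 < ℓ → 1 ≤ n → ¬ ℓ ∣ n → val ℓ n ≡ 0
val-coprime 1<ℓ 1≤n ℓ∤n = val-char 1<ℓ 1≤n (exactPower-coprime ℓ∤n)

val-mul-self : ∀ {ℓ} m → 1 < ℓ → 1 ≤ m → val ℓ (m * ℓ) ≡ suc (val ℓ m)
val-mul-self {ℓ} m 1<ℓ 1≤m with exact-power 1<ℓ m 1≤m
... | v , exact =
  trans (val-char 1<ℓ (ℕP.≤-trans 1≤m (ℕP.m≤m*n m ℓ ⦃ >1⇒nonZero 1<ℓ ⦄))
                  (exactPower-mul-self 1<ℓ exact))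
        (cong suc (sym (val-char 1<ℓ 1≤m exact)))

prime∣prime⇒≡ : ∀ {ℓ q} → Prime ℓ → Prime q → ℓ ∣ q → ℓ ≡ q
prime∣prime⇒≡ pℓ pq ℓ∣q with prime⇒irreducible pq ℓ∣q
... | inj₁ refl = ⊥-elim (ℕP.<-irrefl refl (prime>1 pℓ))
... | inj₂ ℓ≡q  = ℓ≡q

∣-cofactor : ∀ {q} a {b} → Prime q → q ∣ a * b → ¬ q ∣ b → q ∣ a
∣-cofactor a pq q∣ab q∤b with euclidsLemma a _ pq q∣ab
... | inj₁ q∣a = q∣a
... | inj₂ q∣b = ⊥-elim (q∤b q∣b)

∣-mul-other-prime : ∀ {ℓ q} m → Prime ℓ → Prime q → ℓ ≢ q → ℓ ∣ m * q → ℓ ∣ m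
∣-mul-other-prime m pℓ pq ℓ≢q ℓ∣mq = ∣-cofactor m pℓ ℓ∣mq (ℓ≢q ∘ prime∣prime⇒≡ pℓ pq)

prime-power-cancel : ∀ {ℓ q} k m → Prime ℓ → Prime q → ℓ ≢ q → ℓ ^ k ∣ m * q → ℓ ^ k ∣ m
prime-power-cancel zero m _ _ _ _ = 1∣ m
prime-power-cancel {ℓ} {q} (suc k) m pℓ pq ℓ≢q ℓ^1+k∣mq
  with ∣-mul-other-prime m pℓ pq ℓ≢q (∣-trans (m∣m*n (ℓ ^ k)) ℓ^1+k∣mq)
... | divides m' refl =
  subst (_∣ m' * ℓ) (sym (ℓ^suc ℓ k))
    (*-monoˡ-∣ ℓ (prime-power-cancel k m' pℓ pq ℓ≢q
      (*-cancelʳ-∣ ℓ ⦃ prime⇒nonZero pℓ ⦄ (subst₂ _∣_ (ℓ^suc ℓ k) (swap m' ℓ q) ℓ^1+k∣mq))))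
  where
  swap : ∀ a b c → a * b * c ≡ a * c * b
  swap a b c = trans (ℕP.*-assoc a b c) (trans (cong (a *_) (ℕP.*-comm b c)) (sym (ℕP.*-assoc a c b)))

val-mul-other : ∀ {ℓ q} m → Prime ℓ → Prime q → ℓ ≢ q → 1 ≤ m → val ℓ (m * q) ≡ val ℓ m
val-mul-other {ℓ} {q} m pℓ pq ℓ≢q 1≤m with exact-power (prime>1 pℓ) m 1≤m
... | v , exact@(exactly ℓ^v∣m ℓ^1+v∤m) =
  trans (val-char (prime>1 pℓ) 1≤mq
           (exactly (∣m⇒∣m*n q ℓ^v∣m) (ℓ^1+v∤m ∘ prime-power-cancel (suc v) m pℓ pq ℓ≢q)))
        (sym (val-char (prime>1 pℓ) 1≤m exact))
  where
  1≤mq : 1 ≤ m * q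
  1≤mq = ℕP.≤-trans 1≤m (ℕP.m≤m*n m q ⦃ prime⇒nonZero pq ⦄)

-- The identity σ[P](n) − σ[P](n/p) = p^{v_p(n)} σ[P ∖ p](n), describing [p]⁻ on σ[P].
DifferenceFormula : (ℕ → Bool) → ℕ → ℕ → Set
DifferenceFormula P p n = σ[ P ] n - dil p σ[ P ] n ≡ + (p ^ val p n) ℤ.* σ[ P ∖ p ] n

-- For n prime to p both sides are σ[P](n).
difference-coprime : ∀ P {p n} → 1 < p → 1 ≤ n → ¬ p ∣ n → DifferenceFormula P p n
difference-coprime P {p} {n} 1<p 1≤n p∤n = begin
    σ[ P ] n - dil p σ[ P ] n
  ≡⟨ cong (λ x → σ[ P ] n - x) (dil-∤ σ[ P ] p∤n) ⟩
    σ[ P ] n - 0ℤ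
  ≡⟨ ℤP.+-identityʳ _ ⟩
    σ[ P ] n
  ≡⟨ σ-∖-coprime P p∤n ⟨
    σ[ P ∖ p ] n
  ≡⟨ ℤP.*-identityˡ _ ⟨
    + (p ^ 0) ℤ.* σ[ P ∖ p ] n
  ≡⟨ cong (λ v → + (p ^ v) ℤ.* σ[ P ∖ p ] n) (val-coprime 1<p 1≤n p∤n) ⟨
    + (p ^ val p n) ℤ.* σ[ P ∖ p ] n ∎
  where open ≡-Reasoning

-- The formula passes from m to m p.  With A = σ[P](m), A' = σ[P](m/p), B = σ[P ∖ p](m):
-- σ[P](m p) = B + p A and A = B + p A', so σ[P](m p) − A = p (A − A').
difference-mul : ∀ P {p} m → Prime p → Invariant p P → 1 ≤ m →
  DifferenceFormula P p m → DifferenceFormula P p (m * p)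
difference-mul P {p} m pr inv 1≤m formula[m] = begin
    σ[ P ] (m * p) - dil p σ[ P ] (m * p)
  ≡⟨ cong₂ _-_ (σ-p-part P p m inv) (dil-∣ p σ[ P ] m) ⟩
    (σ[ P ∖ p ] (m * p) ℤ.+ + p ℤ.* A) - A
  ≡⟨ cong (λ x → (x ℤ.+ + p ℤ.* A) - A) B[mp]≡B ⟩
    (B ℤ.+ + p ℤ.* A) - A
  ≡⟨ cong (λ x → (B ℤ.+ + p ℤ.* x) - x) A≡B+pA' ⟩
    (B ℤ.+ + p ℤ.* (B ℤ.+ + p ℤ.* A')) - (B ℤ.+ + p ℤ.* A')
  ≡⟨ telescope B A' (+ p) ⟩
    + p ℤ.* ((B ℤ.+ + p ℤ.* A') - A')
  ≡⟨ cong (λ x → + p ℤ.* (x - A')) A≡B+pA' ⟨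
    + p ℤ.* (A - A')
  ≡⟨ cong (+ p ℤ.*_) formula[m] ⟩
    + p ℤ.* (+ (p ^ val p m) ℤ.* B)
  ≡⟨ trans (cong (ℤ._* B) (ℤP.pos-* p (p ^ val p m))) (ℤP.*-assoc (+ p) _ B) ⟨
    + (p * p ^ val p m) ℤ.* B
  ≡⟨ cong₂ (λ v x → + (p ^ v) ℤ.* x) (val-mul-self m (prime>1 pr) 1≤m) B[mp]≡B ⟨
    + (p ^ val p (m * p)) ℤ.* σ[ P ∖ p ] (m * p) ∎
  where
  open ≡-Reasoning
  instance
    p≢0 : NonZero p
    p≢0 = prime⇒nonZero pr
  A A' B : ℤ
  A  = σ[ P ] m
  A' = dil p σ[ P ] m
  B  = σ[ P ∖ p ] m
  A≡B+pA' : A ≡ B ℤ.+ + p ℤ.* A'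
  A≡B+pA' = σ-decomposition P p m inv
  B[mp]≡B : σ[ P ∖ p ] (m * p) ≡ B
  B[mp]≡B = σ-excluded (P ∖ p) m pr (∖-excludes P p) 1≤m
  telescope : ∀ b a' q →
    (b ℤ.+ q ℤ.* (b ℤ.+ q ℤ.* a')) - (b ℤ.+ q ℤ.* a') ≡ q ℤ.* ((b ℤ.+ q ℤ.* a') - a')
  telescope = solve-∀

σ-difference : ∀ P {p} → Prime p → Invariant p P → ∀ n → 1 ≤ n → DifferenceFormula P p n
σ-difference P {p} pr inv = p-induction (prime>1 pr) (DifferenceFormula P p)
  (λ n 1≤n p∤n → difference-coprime P (prime>1 pr) 1≤n p∤n)
  (λ m 1≤m → difference-mul P m pr inv 1≤m)

notDividing : ℕ → ℕ → ℤ
notDividing p n with p ∣? n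
... | yes _ = 0ℤ
... | no  _ = 1ℤ

σ-difference-excluded : ∀ P {p} → Prime p → Excludes p P → ∀ n → 1 ≤ n →
  σ[ P ] n - dil p σ[ P ] n ≡ notDividing p n ℤ.* σ[ P ∖ p ] n
σ-difference-excluded P {p} pr excl n 1≤n with p ∣? n
... | yes (divides m refl) =
  trans (cong (_- σ[ P ] m) (σ-excluded P m pr excl (cofactor-pos m 1≤n))) (ℤP.+-inverseʳ (σ[ P ] m))
... | no p∤n =
  trans (ℤP.+-identityʳ _) (trans (sym (σ-∖-coprime P p∤n)) (sym (ℤP.*-identityˡ _)))

𝟙 : ℕ → ℤ
𝟙 _ = 1ℤ

σ₁ : QExp
σ₁ = σ[ (λ _ → true) ]

module Twist (ψ : ℕ → ℤ) (mult : ∀ m n → ψ (m * n) ≡ ψ m ℤ.* ψ n) where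

  Twisted : QExp → QExp → Set
  Twisted a b = ∀ n → a n ≡ ψ n ℤ.* b n

  mutual
    -- σ_ψ(n) = Σ_{d k = n} d ψ(d) ψ(k) = ψ(n) σ(n).
    σψ-twist : ∀ n → σψ ψ n ≡ ψ n ℤ.* σ₁ n
    σψ-twist n = trans (sumℤ-range1 _ n)
                       (trans (sumTo-cong n (λ d _ _ → summand-twist n d)) (sumTo-*ˡ (ψ n) _ n))

    -- The summand of σψ is local to its definition in Defs, so this type is left to inference:
    -- it states that the d-th summand of σ_ψ(n) is ψ(n) times the d-th summand of σ(n).
    summand-twist : ∀ n d → _
    summand-twist n d with d ∣? n
    ... | yes (divides k n≡kd) =
      trans (reorder (+ d) (ψ d) (ψ k)) (cong (ℤ._* + d) (sym (trans (cong ψ n≡kd) (mult k d))))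
      where
      reorder : ∀ a x y → a ℤ.* x ℤ.* y ≡ y ℤ.* x ℤ.* a
      reorder = solve-∀
    ... | no _ = sym (ℤP.*-zeroʳ (ψ n))

  Eψ-twist : Twisted (Eψ ψ) σ₁
  Eψ-twist zero    = sym (ℤP.*-zeroʳ (ψ 0))
  Eψ-twist (suc n) = σψ-twist (suc n)

  dil-twist : ∀ p {a b} → Twisted a b → ∀ n → ψ p ℤ.* dil p a n ≡ ψ n ℤ.* dil p b n
  dil-twist p {a} {b} a≡ψb n with p ∣? n
  ... | yes (divides k n≡kp) = begin
      ψ p ℤ.* a k           ≡⟨ cong (ψ p ℤ.*_) (a≡ψb k) ⟩
      ψ p ℤ.* (ψ k ℤ.* b k) ≡⟨ ℤP.*-assoc (ψ p) (ψ k) (b k) ⟨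
      ψ p ℤ.* ψ k ℤ.* b k   ≡⟨ cong (ℤ._* b k) (trans (ℤP.*-comm (ψ p) (ψ k)) (sym (mult k p))) ⟩
      ψ (k * p) ℤ.* b k     ≡⟨ cong (λ m → ψ m ℤ.* b k) n≡kp ⟨
      ψ n ℤ.* b k           ∎
    where open ≡-Reasoning
  ... | no _ = trans (ℤP.*-zeroʳ (ψ p)) (sym (ℤP.*-zeroʳ (ψ n)))

  step-twist : ∀ p c c' {a b} → c ≡ c' ℤ.* ψ p → Twisted a b →
    Twisted (λ n → a n - c ℤ.* dil p a n) (λ n → b n - c' ℤ.* dil p b n)
  step-twist p c c' {a} {b} c≡c'ψp a≡ψb n = begin
      a n - c ℤ.* dil p a n
    ≡⟨ cong₂ (λ x y → x - y ℤ.* dil p a n) (a≡ψb n) c≡c'ψp ⟩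
      ψ n ℤ.* b n - c' ℤ.* ψ p ℤ.* dil p a n
    ≡⟨ cong (λ x → ψ n ℤ.* b n - x)
            (trans (ℤP.*-assoc c' (ψ p) _) (cong (c' ℤ.*_) (dil-twist p a≡ψb n))) ⟩
      ψ n ℤ.* b n - c' ℤ.* (ψ n ℤ.* dil p b n)
    ≡⟨ factor (ψ n) (b n) c' (dil p b n) ⟩
      ψ n ℤ.* (b n - c' ℤ.* dil p b n) ∎
    where
    open ≡-Reasoning
    factor : ∀ x y c z → x ℤ.* y - c ℤ.* (x ℤ.* z) ≡ x ℤ.* (y - c ℤ.* z)
    factor = solve-∀

  opPlus-twist : ∀ p {a b} → Twisted a b → Twisted (opPlus ψ p a) (opPlus 𝟙 p b)
  opPlus-twist p = step-twist p (+ p ℤ.* ψ p) (+ p ℤ.* 1ℤ) (cong (ℤ._* ψ p) (sym (ℤP.*-identityʳ (+ p))))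

  opMinus-twist : ∀ p {a b} → Twisted a b → Twisted (opMinus ψ p a) (opMinus 𝟙 p b)
  opMinus-twist p = step-twist p (ψ p) 1ℤ (sym (ℤP.*-identityˡ (ψ p)))

  foldr-twist : ∀ {op op' : ℕ → QExp → QExp} → (∀ p {a b} → Twisted a b → Twisted (op p a) (op' p b)) →
    ∀ ps {a b} → Twisted a b → Twisted (foldr op a ps) (foldr op' b ps)
  foldr-twist op-twist []       a≡ψb = a≡ψb
  foldr-twist op-twist (p ∷ ps) a≡ψb = op-twist p (foldr-twist op-twist ps a≡ψb)

  EMLψ-twist : ∀ Mf Lf →
    Twisted (EMLψ ψ Mf Lf) (opMinusK 𝟙 Lf (opPlusK 𝟙 Mf σ₁))
  EMLψ-twist Mf Lf =
    foldr-twist opMinus-twist (primeDivisors Lf) (foldr-twist opPlus-twist (primeDivisors Mf) Eψ-twist)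

-- Agreement at all positive indices.
_≈⁺_ : QExp → QExp → Set
a ≈⁺ b = ∀ n → 1 ≤ n → a n ≡ b n

step-cong⁺ : ∀ p c {a b} → a ≈⁺ b →
  (λ n → a n - c ℤ.* dil p a n) ≈⁺ (λ n → b n - c ℤ.* dil p b n)
step-cong⁺ p c {a} {b} a≈b n 1≤n with p ∣? n
... | yes (divides k refl) = cong₂ (λ x y → x - c ℤ.* y) (a≈b (k * p) 1≤n) (a≈b k (cofactor-pos k 1≤n))
... | no _                 = cong (λ x → x - c ℤ.* 0ℤ) (a≈b n 1≤n)

primeTo : List ℕ → ℕ → Bool
primeTo qs = foldr (λ q P → P ∖ q) (λ _ → true) qs

primeTo-invariant : ∀ {p qs} → Prime p → All Prime qs → All (p ≢_) qs → Invariant p (primeTo qs)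
primeTo-invariant pp [] [] e = refl
primeTo-invariant {p} {q ∷ qs} pp (pq ∷ prs) (p≢q ∷ p≢qs) e with q ∣? e
... | yes q∣e = ∖-∣ (primeTo qs) (∣m⇒∣m*n p q∣e)
... | no q∤e  = trans (∖-∤ (primeTo qs) (q∤e ∘ ∣-mul-other-prime e pq pp (p≢q ∘ sym)))
                      (primeTo-invariant pp prs p≢qs e)

∖-true : ∀ P {p d} → (P ∖ p) d ≡ true → P d ≡ true
∖-true P {p} {d} holds with p ∣? d
... | yes _ with () ← holds
... | no _  = holds

primeTo-excludes : ∀ {q qs} → q ∈ qs → Excludes q (primeTo qs)
primeTo-excludes {q} {r ∷ qs} (here refl) d holds = ∖-excludes (primeTo qs) q d holds
primeTo-excludes {q} {r ∷ qs} (there q∈qs) d holds =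
  primeTo-excludes q∈qs d (∖-true (primeTo qs) {r} holds)

opPlus-σ : ∀ P p .⦃ _ : NonZero p ⦄ → Invariant p P → ∀ n → opPlus 𝟙 p σ[ P ] n ≡ σ[ P ∖ p ] n
opPlus-σ P p inv n =
  trans (cong (λ x → x - + p ℤ.* 1ℤ ℤ.* dil p σ[ P ] n) (σ-decomposition P p n inv))
        (cancel (σ[ P ∖ p ] n) (+ p) (dil p σ[ P ] n))
  where
  cancel : ∀ b c x → b ℤ.+ c ℤ.* x - c ℤ.* 1ℤ ℤ.* x ≡ b
  cancel = solve-∀

plus-stage : ∀ ps → All Prime ps → Unique ps → foldr (opPlus 𝟙) σ₁ ps ≈⁺ σ[ primeTo ps ]
plus-stage []       _          _                  n _   = refl
plus-stage (p ∷ ps) (pp ∷ pps) (p≢ps ∷ unique-ps) n 1≤n =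
  trans (step-cong⁺ p (+ p ℤ.* 1ℤ) (plus-stage ps pps unique-ps) n 1≤n)
        (opPlus-σ (primeTo ps) p ⦃ prime⇒nonZero pp ⦄ (primeTo-invariant pp pps p≢ps) n)

-- The factor by which [q]⁻ multiplies, given the primes of Mf have been removed by [Mf]⁺:
-- [q ∤ n] if q ∣ Mf, and q^{v_q(n)} otherwise.
localFactor : ℕ → ℕ → ℕ → ℤ
localFactor Mf q n with q ∣? Mf
... | yes _ = notDividing q n
... | no  _ = + (q ^ val q n)

weight : ℕ → List ℕ → ℕ → ℤ
weight Mf []       n = 1ℤ
weight Mf (q ∷ qs) n = localFactor Mf q n ℤ.* weight Mf qs n

opMinus-σ : ∀ Mf P {q} → Prime q → (q ∣ Mf → Excludes q P) → (¬ q ∣ Mf → Invariant q P) →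
  ∀ n → 1 ≤ n → σ[ P ] n - dil q σ[ P ] n ≡ localFactor Mf q n ℤ.* σ[ P ∖ q ] n
opMinus-σ Mf P {q} pq excl inv n 1≤n with q ∣? Mf
... | yes q∣Mf = σ-difference-excluded P pq (excl q∣Mf) n 1≤n
... | no q∤Mf  = σ-difference P pq (inv q∤Mf) n 1≤n

notDividing-invariant : ∀ {ℓ q} m → Prime ℓ → Prime q → ℓ ≢ q →
  notDividing ℓ (m * q) ≡ notDividing ℓ m
notDividing-invariant {ℓ} {q} m pℓ pq ℓ≢q with ℓ ∣? m | ℓ ∣? (m * q)
... | yes _    | yes _    = refl
... | no _     | no _     = refl
... | yes ℓ∣m  | no ℓ∤mq  = ⊥-elim (ℓ∤mq (∣m⇒∣m*n q ℓ∣m))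
... | no ℓ∤m   | yes ℓ∣mq = ⊥-elim (ℓ∤m (∣-mul-other-prime m pℓ pq ℓ≢q ℓ∣mq))

localFactor-invariant : ∀ Mf {ℓ q} m → Prime ℓ → Prime q → ℓ ≢ q → 1 ≤ m →
  localFactor Mf ℓ (m * q) ≡ localFactor Mf ℓ m
localFactor-invariant Mf {ℓ} m pℓ pq ℓ≢q 1≤m with ℓ ∣? Mf
... | yes _ = notDividing-invariant m pℓ pq ℓ≢q
... | no _  = cong (λ v → + (ℓ ^ v)) (val-mul-other m pℓ pq ℓ≢q 1≤m)

weight-invariant : ∀ Mf {q qs} m → Prime q → All Prime qs → All (q ≢_) qs → 1 ≤ m →
  weight Mf qs (m * q) ≡ weight Mf qs m
weight-invariant Mf m pq []           []           1≤m = refl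
weight-invariant Mf m pq (pℓ ∷ pℓs) (q≢ℓ ∷ q≢ℓs) 1≤m =
  cong₂ ℤ._*_ (localFactor-invariant Mf m pℓ pq (q≢ℓ ∘ sym) 1≤m)
              (weight-invariant Mf m pq pℓs q≢ℓs 1≤m)

dil-scale : ∀ p .⦃ _ : NonZero p ⦄ (c h : QExp) → (∀ m → 1 ≤ m → c (m * p) ≡ c m) →
  ∀ n → 1 ≤ n → dil p (λ k → c k ℤ.* h k) n ≡ c n ℤ.* dil p h n
dil-scale p c h c-inv n 1≤n with p ∣? n
... | yes (divides m refl) = cong (ℤ._* h m) (sym (c-inv m (cofactor-pos m 1≤n)))
... | no _                 = sym (ℤP.*-zeroʳ (c n))

module MinusStage (Mf : ℕ) (Pm : List ℕ) (Pm-prime : All Prime Pm) (Pm-∣ : All (_∣ Mf) Pm) where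

  minus-stage : ∀ ps → All Prime ps → Unique ps → All (λ q → q ∣ Mf → q ∈ Pm) ps →
    ∀ {U} → U ≈⁺ σ[ primeTo Pm ] →
    foldr (opMinus 𝟙) U ps ≈⁺ (λ n → weight Mf ps n ℤ.* σ[ primeTo (ps ++ Pm) ] n)
  minus-stage [] _ _ _ U≈σ n 1≤n = trans (U≈σ n 1≤n) (sym (ℤP.*-identityˡ _))
  minus-stage (q ∷ ps) (pq ∷ pps) (q≢ps ∷ unique-ps) (q∣Mf⇒q∈Pm ∷ ps∈Pm) {U} U≈σ n 1≤n = begin
      F n - 1ℤ ℤ.* dil q F n
    ≡⟨ step-cong⁺ q 1ℤ (minus-stage ps pps unique-ps ps∈Pm U≈σ) n 1≤n ⟩
      w n ℤ.* σ[ P ] n - 1ℤ ℤ.* dil q (λ k → w k ℤ.* σ[ P ] k) n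
    ≡⟨ cong (λ x → w n ℤ.* σ[ P ] n - 1ℤ ℤ.* x)
            (dil-scale q ⦃ prime⇒nonZero pq ⦄ w σ[ P ] (λ m → weight-invariant Mf m pq pps q≢ps) n 1≤n) ⟩
      w n ℤ.* σ[ P ] n - 1ℤ ℤ.* (w n ℤ.* dil q σ[ P ] n)
    ≡⟨ factor (w n) (σ[ P ] n) (dil q σ[ P ] n) ⟩
      w n ℤ.* (σ[ P ] n - dil q σ[ P ] n)
    ≡⟨ cong (w n ℤ.*_) (opMinus-σ Mf P pq excludes invariant n 1≤n) ⟩
      w n ℤ.* (localFactor Mf q n ℤ.* σ[ P ∖ q ] n)
    ≡⟨ ℤP.*-assoc (w n) _ _ ⟨
      w n ℤ.* localFactor Mf q n ℤ.* σ[ P ∖ q ] n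
    ≡⟨ cong (ℤ._* σ[ P ∖ q ] n) (ℤP.*-comm (w n) _) ⟩
      weight Mf (q ∷ ps) n ℤ.* σ[ primeTo (q ∷ ps ++ Pm) ] n ∎
    where
    open ≡-Reasoning
    F : QExp
    F = foldr (opMinus 𝟙) U ps
    w : ℕ → ℤ
    w = weight Mf ps
    P : ℕ → Bool
    P = primeTo (ps ++ Pm)
    factor : ∀ x y z → x ℤ.* y - 1ℤ ℤ.* (x ℤ.* z) ≡ x ℤ.* (y - z)
    factor = solve-∀
    excludes : q ∣ Mf → Excludes q P
    excludes q∣Mf = primeTo-excludes (∈-++⁺ʳ ps (q∣Mf⇒q∈Pm q∣Mf))
    invariant : ¬ q ∣ Mf → Invariant q P
    invariant q∤Mf = primeTo-invariant pq (All.++⁺ pps Pm-prime)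
      (All.++⁺ q≢ps (All.map (λ ℓ∣Mf q≡ℓ → q∤Mf (subst (_∣ Mf) (sym q≡ℓ) ℓ∣Mf)) Pm-∣))

powerProduct : List ℕ → ℕ → ℕ
powerProduct qs n = prodℕ (map (λ ℓ → ℓ ^ val ℓ n) qs)

weight-split : ∀ Mf qs n →
  weight Mf qs n ≡ (if primeTo (filter (_∣? Mf) qs) n
                    then + powerProduct (filter (¬? ∘ (_∣? Mf)) qs) n else 0ℤ)
weight-split Mf [] n = refl
weight-split Mf (q ∷ qs) n with q ∣? Mf
... | yes _ with q ∣? n
...   | yes _ = ℤP.*-zeroˡ (weight Mf qs n)
...   | no _  = trans (ℤP.*-identityˡ _) (weight-split Mf qs n)
weight-split Mf (q ∷ qs) n | no _ =
  trans (cong (+ (q ^ val q n) ℤ.*_) (weight-split Mf qs n)) (scale (primeTo (filter (_∣? Mf) qs) n))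
  where
  Π : ℕ
  Π = powerProduct (filter (¬? ∘ (_∣? Mf)) qs) n
  scale : ∀ b → + (q ^ val q n) ℤ.* (if b then + Π else 0ℤ) ≡ (if b then + (q ^ val q n ℕ.* Π) else 0ℤ)
  scale true  = sym (ℤP.pos-* (q ^ val q n) Π)
  scale false = ℤP.*-zeroʳ (+ (q ^ val q n))

divisor-pos : ∀ {a b} → 1 ≤ b → a ∣ b → 1 ≤ a
divisor-pos {zero} 1≤b 0∣b = ⊥-elim (ℕP.<-irrefl (sym (0∣⇒≡0 0∣b)) 1≤b)
divisor-pos {suc a} _ _ = s≤s z≤n

prime-factor : ∀ n → 1 < n → Σ ℕ λ q → Prime q × q ∣ n
prime-factor n 1<n with factorise n ⦃ >1⇒nonZero 1<n ⦄
... | record { factors = [] ; isFactorisation = n≡1 } = ⊥-elim (ℕP.<-irrefl (sym n≡1) 1<n)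
... | record { factors = q ∷ qs ; isFactorisation = n≡∏ ; factorsPrime = pq ∷ _ } =
  q , pq , subst (q ∣_) (sym n≡∏) (m∣m*n (product qs))

gcd≡1-intro : ∀ a b → 1 ≤ b → (∀ q → Prime q → q ∣ a → q ∣ b → ⊥) → gcd a b ≡ 1
gcd≡1-intro a b 1≤b no-common = coprime⇒gcd≡1 coprime
  where
  coprime : Coprime a b
  coprime {zero}        (_ , 0∣b)   = ⊥-elim (ℕP.<-irrefl (sym (0∣⇒≡0 0∣b)) 1≤b)
  coprime {suc zero}    _           = refl
  coprime {suc (suc i)} (i∣a , i∣b) with prime-factor (suc (suc i)) (s≤s (s≤s z≤n))
  ... | q , pq , q∣i = ⊥-elim (no-common q pq (∣-trans q∣i i∣a) (∣-trans q∣i i∣b))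

gcd≡1-elim : ∀ {a b q} → gcd a b ≡ 1 → Prime q → q ∣ a → q ∣ b → ⊥
gcd≡1-elim gcd≡1 pq q∣a q∣b =
  ℕP.<-irrefl (sym (∣1⇒≡1 (subst (_ ∣_) gcd≡1 (gcd-greatest q∣a q∣b)))) (prime>1 pq)

primeTo-true : ∀ qs {d} → All (λ q → ¬ q ∣ d) qs → primeTo qs d ≡ true
primeTo-true []       []             = refl
primeTo-true (q ∷ qs) (q∤d ∷ qs∤d) = trans (∖-∤ (primeTo qs) q∤d) (primeTo-true qs qs∤d)

primeTo-gcd : ∀ qs {d K} → 1 ≤ K → All Prime qs → All (_∣ K) qs →
  (∀ q → Prime q → q ∣ d → q ∣ K → q ∈ qs) → primeTo qs d ≡ does (gcd d K ℕ.≟ 1)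
primeTo-gcd qs {d} {K} 1≤K qs-prime qs∣K covers = by-cases (gcd d K ℕ.≟ 1)
  where
  by-cases : Dec (gcd d K ≡ 1) → primeTo qs d ≡ does (gcd d K ℕ.≟ 1)
  by-cases (yes gcd≡1) =
    trans (primeTo-true qs
             (All.zipWith (λ (pq , q∣K) q∣d → gcd≡1-elim gcd≡1 pq q∣d q∣K) (qs-prime , qs∣K)))
          (sym (dec-true (gcd d K ℕ.≟ 1) gcd≡1))
  by-cases (no gcd≢1) =
    trans (¬-not λ holds → gcd≢1 (gcd≡1-intro d K 1≤K λ q pq q∣d q∣K →
                             primeTo-excludes (covers q pq q∣d q∣K) d holds q∣d))
          (sym (dec-false (gcd d K ℕ.≟ 1) gcd≢1))

primeDivisors-spec : ∀ K → All (λ p → Prime p × p ∣ K) (primeDivisors K)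
primeDivisors-spec K = All.all-filter (λ p → prime? p ×-dec (p ∣? K)) (range1 K)

primeDivisors-prime : ∀ K → All Prime (primeDivisors K)
primeDivisors-prime K = All.map proj₁ (primeDivisors-spec K)

primeDivisors-∣ : ∀ K → All (_∣ K) (primeDivisors K)
primeDivisors-∣ K = All.map proj₂ (primeDivisors-spec K)

primeDivisors-unique : ∀ K → Unique (primeDivisors K)
primeDivisors-unique K = Unique.filter⁺ (λ p → prime? p ×-dec (p ∣? K))
  (Unique.applyUpTo⁺₁ suc K λ i<j _ 1+i≡1+j → ℕP.<-irrefl (ℕP.suc-injective 1+i≡1+j) i<j)

∈-primeDivisors : ∀ {p K} → 1 ≤ K → Prime p → p ∣ K → p ∈ primeDivisors K
∈-primeDivisors {zero}  _   pp _   = ⊥-elim (ℕ.≢-nonZero⁻¹ 0 ⦃ prime⇒nonZero pp ⦄ refl)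
∈-primeDivisors {suc _} 1≤K pp p∣K =
  ∈-filter⁺ (λ p → prime? p ×-dec (p ∣? _))
            (∈-applyUpTo⁺ suc (∣⇒≤ ⦃ >-nonZero 1≤K ⦄ p∣K)) (pp , p∣K)

sum-filtered-divisors : ∀ n P {Q : ℕ → Set} (Q? : Decidable Q) → (∀ d → P d ≡ does (Q? d)) →
  sumℤ (map +_ (filter Q? (divisors n))) ≡ σ[ P ] n
sum-filtered-divisors n P Q? P≡Q? = trans (over (range1 n)) (sumℤ-range1 (divisorTerm P n) n)
  where
  over : ∀ xs → sumℤ (map +_ (filter Q? (filter (_∣? n) xs))) ≡ sumℤ (map (divisorTerm P n) xs)
  over []       = refl
  over (x ∷ xs) with x ∣? n
  ... | no _ = trans (over xs) (sym (ℤP.+-identityˡ _))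
  ... | yes _ rewrite P≡Q? x with Q? x
  ...   | yes _ = cong (λ s → + x ℤ.+ s) (over xs)
  ...   | no _  = trans (over xs) (sym (ℤP.+-identityˡ _))

filter-filter : ∀ {A B : ℕ → Set} (A? : Decidable A) (B? : Decidable B) xs →
  filter A? (filter B? xs) ≡ filter (B? ∩? A?) xs
filter-filter A? B? []       = refl
filter-filter A? B? (x ∷ xs) with does (B? x)
... | false = filter-filter A? B? xs
... | true with does (A? x)
...   | true  = cong (x ∷_) (filter-filter A? B? xs)
...   | false = filter-filter A? B? xs

filter-range1-extend : ∀ {C : ℕ → Set} (C? : Decidable C) {N N'} → N ≤ N' → (∀ x → N < x → ¬ C x) →
  filter C? (range1 N') ≡ filter C? (range1 N)
filter-range1-extend C? {N} N≤N' beyond with ℕP.m≤n⇒∃[o]m+o≡n N≤N'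
... | k , refl = extend k
  where
  extend : ∀ k → filter C? (range1 (N + k)) ≡ filter C? (range1 N)
  extend zero    = cong (λ m → filter C? (range1 m)) (ℕP.+-identityʳ N)
  extend (suc k) = begin
      filter C? (range1 (N + suc k))
    ≡⟨ cong (λ m → filter C? (range1 m)) (ℕP.+-suc N k) ⟩
      filter C? (range1 (suc (N + k)))
    ≡⟨ cong (filter C?) (LP.applyUpTo-∷ʳ suc (N + k)) ⟨
      filter C? (range1 (N + k) ++ [ suc (N + k) ])
    ≡⟨ LP.filter-++ C? (range1 (N + k)) _ ⟩
      filter C? (range1 (N + k)) ++ filter C? [ suc (N + k) ]
    ≡⟨ cong (filter C? (range1 (N + k)) ++_) (LP.filter-reject C? (beyond _ (s≤s (ℕP.m≤m+n N k)))) ⟩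
      filter C? (range1 (N + k)) ++ []
    ≡⟨ LP.++-identityʳ _ ⟩
      filter C? (range1 (N + k))
    ≡⟨ extend k ⟩
      filter C? (range1 N) ∎
    where open ≡-Reasoning

factor-∣ : ∀ {a b c} → a * b ≡ c → a ∣ c
factor-∣ {a} {b} refl = m∣m*n b

squareFree-disjoint : ∀ {D a b q} → SquareFree D → a * b ∣ D → Prime q → q ∣ a → q ∣ b → ⊥
squareFree-disjoint sqf ab∣D pq q∣a q∣b = sqf _ pq (∣-trans (*-pres-∣ q∣a q∣b) ab∣D)

module Setting (D M L f : ℕ) ⦃ _ : NonZero D ⦄ ⦃ _ : NonZero M ⦄ ⦃ _ : NonZero f ⦄
  (sqf : SquareFree D) (M∣D : M ∣ D) (L∣D : L ∣ D) (D∣ML : D ∣ M * L) (f∣N : f ∣ gcd M L) where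

  N Mf Lf Df DM : ℕ
  N  = gcd M L
  Mf = M / f
  Lf = L / f
  Df = D / f
  DM = D / M

  f∣M : f ∣ M
  f∣M = ∣-trans f∣N (gcd[m,n]∣m M L)
  f∣L : f ∣ L
  f∣L = ∣-trans f∣N (gcd[m,n]∣n M L)

  Mf*f : Mf * f ≡ M
  Mf*f = m/n*n≡m f∣M
  Lf*f : Lf * f ≡ L
  Lf*f = m/n*n≡m f∣L
  Df*f : Df * f ≡ D
  Df*f = m/n*n≡m (∣-trans f∣M M∣D)
  DM*M : DM * M ≡ D
  DM*M = m/n*n≡m M∣D

  1≤D : 1 ≤ D
  1≤D = ℕ.>-nonZero⁻¹ D
  1≤Mf : 1 ≤ Mf
  1≤Mf = divisor-pos (divisor-pos 1≤D M∣D) (factor-∣ Mf*f)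
  1≤Lf : 1 ≤ Lf
  1≤Lf = divisor-pos (divisor-pos 1≤D L∣D) (factor-∣ Lf*f)
  1≤Df : 1 ≤ Df
  1≤Df = divisor-pos 1≤D (factor-∣ Df*f)
  1≤DM : 1 ≤ DM
  1≤DM = divisor-pos 1≤D (factor-∣ DM*M)
  1≤N : 1 ≤ N
  1≤N = divisor-pos (divisor-pos 1≤D M∣D) (gcd[m,n]∣m M L)

  Mf∣Df : Mf ∣ Df
  Mf∣Df = *-cancelʳ-∣ f (subst₂ _∣_ (sym Mf*f) (sym Df*f) M∣D)
  Lf∣Df : Lf ∣ Df
  Lf∣Df = *-cancelʳ-∣ f (subst₂ _∣_ (sym Lf*f) (sym Df*f) L∣D)
  DM∣Df : DM ∣ Df
  DM∣Df = *-cancelʳ-∣ f (subst (DM * f ∣_) (trans DM*M (sym Df*f)) (*-monoʳ-∣ DM f∣M))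

  prime-∣Df : ∀ {q} → Prime q → q ∣ Df → q ∣ Mf ⊎ q ∣ Lf
  prime-∣Df {q} pq q∣Df =
    Sum.map (λ q∣M → ∣-cofactor Mf pq (subst (q ∣_) (sym Mf*f) q∣M) q∤f)
            (λ q∣L → ∣-cofactor Lf pq (subst (q ∣_) (sym Lf*f) q∣L) q∤f)
            (euclidsLemma M L pq (∣-trans (∣-trans q∣Df (factor-∣ Df*f)) D∣ML))
    where
    q∤f : ¬ q ∣ f
    q∤f = squareFree-disjoint sqf (subst (Df * f ∣_) Df*f ∣-refl) pq q∣Df

  prime-∣N : ∀ {q} → Prime q → ¬ q ∣ f → q ∣ N → q ∣ Mf × q ∣ Lf
  prime-∣N pq q∤f q∣N =
    ∣-cofactor Mf pq (subst (_ ∣_) (sym Mf*f) (∣-trans q∣N (gcd[m,n]∣m M L))) q∤f ,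
    ∣-cofactor Lf pq (subst (_ ∣_) (sym Lf*f) (∣-trans q∣N (gcd[m,n]∣n M L))) q∤f

  prime-∣DM : ∀ {q} → Prime q → q ∣ DM → q ∣ Lf × ¬ q ∣ Mf
  prime-∣DM {q} pq q∣DM = q∣Lf , (q∤M ∘ λ q∣Mf → ∣-trans q∣Mf (factor-∣ Mf*f))
    where
    q∤M : ¬ q ∣ M
    q∤M = squareFree-disjoint sqf (subst (DM * M ∣_) DM*M ∣-refl) pq q∣DM
    q∣Lf : q ∣ Lf
    q∣Lf with euclidsLemma M L pq (∣-trans (∣-trans q∣DM (factor-∣ DM*M)) D∣ML)
    ... | inj₁ q∣M = ⊥-elim (q∤M q∣M)
    ... | inj₂ q∣L =
      ∣-cofactor Lf pq (subst (q ∣_) (sym Lf*f) q∣L) (q∤M ∘ λ q∣f → ∣-trans q∣f f∣M)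

  ∣DM-prime : ∀ {q} → Prime q → q ∣ Lf → ¬ q ∣ Mf → q ∣ DM
  ∣DM-prime {q} pq q∣Lf q∤Mf = ∣-cofactor DM pq (subst (q ∣_) (sym DM*M) q∣D) q∤M
    where
    q∣D : q ∣ D
    q∣D = ∣-trans q∣Lf (∣-trans (factor-∣ Lf*f) L∣D)
    q∤M : ¬ q ∣ M
    q∤M q∣M with q ∣? f
    ... | yes q∣f = squareFree-disjoint sqf (subst (_∣ D) (sym Lf*f) L∣D) pq q∣Lf q∣f
    ... | no q∤f  = q∤Mf (∣-cofactor Mf pq (subst (q ∣_) (sym Mf*f) q∣M) q∤f)

  Pm Pl : List ℕ
  Pm = primeDivisors Mf
  Pl = primeDivisors Lf

  untwisted-stages :
    opMinusK 𝟙 Lf (opPlusK 𝟙 Mf σ₁) ≈⁺ (λ n → weight Mf Pl n ℤ.* σ[ primeTo (Pl ++ Pm) ] n)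
  untwisted-stages =
    MinusStage.minus-stage Mf Pm (primeDivisors-prime Mf) (primeDivisors-∣ Mf)
      Pl (primeDivisors-prime Lf) (primeDivisors-unique Lf)
      (All.map (λ (pq , _) q∣Mf → ∈-primeDivisors 1≤Mf pq q∣Mf) (primeDivisors-spec Lf))
      (plus-stage Pm (primeDivisors-prime Mf) (primeDivisors-unique Mf))

  primeTo-Df : ∀ d → primeTo (Pl ++ Pm) d ≡ does (gcd d Df ℕ.≟ 1)
  primeTo-Df d =
    primeTo-gcd (Pl ++ Pm) 1≤Df (All.++⁺ (primeDivisors-prime Lf) (primeDivisors-prime Mf))
      (All.++⁺ (All.map (λ q∣Lf → ∣-trans q∣Lf Lf∣Df) (primeDivisors-∣ Lf))
               (All.map (λ q∣Mf → ∣-trans q∣Mf Mf∣Df) (primeDivisors-∣ Mf)))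
      λ q pq _ q∣Df → Sum.[ (λ q∣Mf → ∈-++⁺ʳ Pl (∈-primeDivisors 1≤Mf pq q∣Mf)) ,
                            (λ q∣Lf → ∈-++⁺ˡ (∈-primeDivisors 1≤Lf pq q∣Lf)) ] (prime-∣Df pq q∣Df)

  Pshared : List ℕ
  Pshared = filter (_∣? Mf) Pl

  primeTo-N : ∀ n → gcd n f ≡ 1 → primeTo Pshared n ≡ does (gcd n N ℕ.≟ 1)
  primeTo-N n n⊥f =
    primeTo-gcd Pshared 1≤N (All.filter⁺ (_∣? Mf) (primeDivisors-prime Lf))
      (All.zipWith (λ (q∣Mf , q∣Lf) →
                      gcd-greatest (∣-trans q∣Mf (factor-∣ Mf*f)) (∣-trans q∣Lf (factor-∣ Lf*f)))
                   (All.all-filter (_∣? Mf) Pl , All.filter⁺ (_∣? Mf) (primeDivisors-∣ Lf)))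
      λ q pq q∣n q∣N →
        let (q∣Mf , q∣Lf) = prime-∣N pq (gcd≡1-elim n⊥f pq q∣n) q∣N
        in ∈-filter⁺ (_∣? Mf) (∈-primeDivisors 1≤Lf pq q∣Lf) q∣Mf

  Pcoprime : List ℕ
  Pcoprime = filter (¬? ∘ (_∣? Mf)) Pl

  primes-DM : Pcoprime ≡ primeDivisors DM
  primes-DM = begin
      filter (¬? ∘ (_∣? Mf)) (filter (λ p → prime? p ×-dec (p ∣? Lf)) (range1 Lf))
    ≡⟨ filter-filter (¬? ∘ (_∣? Mf)) (λ p → prime? p ×-dec (p ∣? Lf)) (range1 Lf) ⟩
      filter ((λ p → prime? p ×-dec (p ∣? Lf)) ∩? (¬? ∘ (_∣? Mf))) (range1 Lf)
    ≡⟨ LP.filter-≐ _ C? same-primes (range1 Lf) ⟩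
      filter C? (range1 Lf)
    ≡⟨ filter-range1-extend C? (∣⇒≤ ⦃ ℕ.>-nonZero 1≤Df ⦄ Lf∣Df)
                            (beyond Lf 1≤Lf (λ pq q∣DM → proj₁ (prime-∣DM pq q∣DM))) ⟨
      filter C? (range1 Df)
    ≡⟨ filter-range1-extend C? (∣⇒≤ ⦃ ℕ.>-nonZero 1≤Df ⦄ DM∣Df)
                            (beyond DM 1≤DM (λ _ q∣DM → q∣DM)) ⟩
      filter C? (range1 DM) ∎
    where
    open ≡-Reasoning
    C? : Decidable (λ p → Prime p × p ∣ DM)
    C? p = prime? p ×-dec (p ∣? DM)
    same-primes : (λ p → (Prime p × p ∣ Lf) × ¬ p ∣ Mf) ≐ (λ p → Prime p × p ∣ DM)
    same-primes = (λ ((pq , q∣Lf) , q∤Mf) → pq , ∣DM-prime pq q∣Lf q∤Mf) ,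
                  (λ (pq , q∣DM) → (pq , proj₁ (prime-∣DM pq q∣DM)) , proj₂ (prime-∣DM pq q∣DM))
    beyond : ∀ K → 1 ≤ K → (∀ {q} → Prime q → q ∣ DM → q ∣ K) → ∀ x → K < x → ¬ (Prime x × x ∣ DM)
    beyond K 1≤K ∣K x K<x (px , x∣DM) = ℕP.<⇒≱ K<x (∣⇒≤ ⦃ ℕ.>-nonZero 1≤K ⦄ (∣K px x∣DM))

  identification : ∀ n → gcd n f ≡ 1 →
    weight Mf Pl n ℤ.* σ[ primeTo (Pl ++ Pm) ] n ≡ σML N Df DM n
  identification n n⊥f with gcd n N ℕ.≟ 1
  ... | yes n⊥N = begin
      weight Mf Pl n ℤ.* S
    ≡⟨ cong (ℤ._* S) (weight-split Mf Pl n) ⟩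
      (if primeTo Pshared n then + powerProduct Pcoprime n else 0ℤ) ℤ.* S
    ≡⟨ cong (λ b → (if b then + powerProduct Pcoprime n else 0ℤ) ℤ.* S)
            (trans (primeTo-N n n⊥f) (dec-true (gcd n N ℕ.≟ 1) n⊥N)) ⟩
      + powerProduct Pcoprime n ℤ.* S
    ≡⟨ ℤP.*-comm _ S ⟩
      S ℤ.* + powerProduct Pcoprime n
    ≡⟨ cong₂ (λ s qs → s ℤ.* + powerProduct qs n)
             (sum-filtered-divisors n (primeTo (Pl ++ Pm)) (λ d → gcd d Df ℕ.≟ 1) primeTo-Df) (sym primes-DM) ⟨
      sumℤ (map +_ (filter (λ d → gcd d Df ℕ.≟ 1) (divisors n))) ℤ.* + powerProduct (primeDivisors DM) n ∎
    where
    open ≡-Reasoning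
    S : ℤ
    S = σ[ primeTo (Pl ++ Pm) ] n
  ... | no n⊥̸N = begin
      weight Mf Pl n ℤ.* σ[ primeTo (Pl ++ Pm) ] n
    ≡⟨ cong (ℤ._* σ[ primeTo (Pl ++ Pm) ] n) (weight-split Mf Pl n) ⟩
      (if primeTo Pshared n then + powerProduct Pcoprime n else 0ℤ) ℤ.* σ[ primeTo (Pl ++ Pm) ] n
    ≡⟨ cong (λ b → (if b then + powerProduct Pcoprime n else 0ℤ) ℤ.* σ[ primeTo (Pl ++ Pm) ] n)
            (trans (primeTo-N n n⊥f) (dec-false (gcd n N ℕ.≟ 1) n⊥̸N)) ⟩
      0ℤ ℤ.* σ[ primeTo (Pl ++ Pm) ] n
    ≡⟨ ℤP.*-zeroˡ (σ[ primeTo (Pl ++ Pm) ] n) ⟩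
      0ℤ ∎
    where open ≡-Reasoning

lemma4p8 : (D C M L f : ℕ) (ψ : ℕ → ℤ) → ⦃ _ : NonZero D ⦄ → ⦃ _ : NonZero M ⦄ → ⦃ _ : NonZero f ⦄ →
    SquareFree D → C ∣ D →
    M ∣ D → L ∣ D → M ≢ 1 → D ∣ M * L → M * L ∣ D * C →
    f ∣ gcd M L → DirichletChar f ψ → Quadratic f ψ → Primitive f ψ →
    ∀ n → 1 ≤ n →
      EMLψ ψ (M / f) (L / f) n ≡ σML (gcd M L) (D / f) (D / M) n ℤ.* ψ n
lemma4p8 D C M L f ψ sqf _ M∣D L∣D _ D∣ML _ f∣gcd χ _ _ n 1≤n =
  trans (EMLψ-twist Mf Lf n) (by-cases (gcd n f ℕ.≟ 1))
  where
  open Setting D M L f sqf M∣D L∣D D∣ML f∣gcd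
  open Twist ψ (DirichletChar.mult χ)
  E₁ : QExp
  E₁ = opMinusK 𝟙 Lf (opPlusK 𝟙 Mf σ₁)
  by-cases : Dec (gcd n f ≡ 1) → ψ n ℤ.* E₁ n ≡ σML N Df DM n ℤ.* ψ n
  by-cases (yes n⊥f) =
    trans (ℤP.*-comm (ψ n) (E₁ n)) (cong (ℤ._* ψ n) (trans (untwisted-stages n 1≤n) (identification n n⊥f)))
  by-cases (no n⊥̸f) = trans (cong (ℤ._* E₁ n) ψn≡0) (trans (ℤP.*-zeroˡ (E₁ n))
    (sym (trans (cong (σML N Df DM n ℤ.*_) ψn≡0) (ℤP.*-zeroʳ (σML N Df DM n)))))
    where
    ψn≡0 : ψ n ≡ 0ℤ
    ψn≡0 = proj₂ (DirichletChar.zero-iff χ n) n⊥̸f
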